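{- For any $n\ge0$ and $k\ge2$, $|\mathcal T^k_n|=M^{k-1}_{n,0}(\vec1,\vec1)$, where $\vec1=(1,\dots,1)$ is the $(k-1)$-tuple of ones.
   Context: A $k$-ary tree is a rooted plane (ordered) tree in which every vertex has at most $k$ children, the children of each vertex being linearly ordered from left to right. $\mathcal T^k_n$ is the set of $k$-ary trees with exactly $n$ edges. An order-$\ell$ Motzkin path of length $n$ and height $m$ is an integer lattice path from $(0,0)$ to $(n,m)$ using steps $U=(1,1)$ and $D_i=(1,-i)$ for $0\le i\le \ell$, never going below $y=0$. For $\ell$-tuples of non-negative integers $\vec\alpha,\vec\beta$, an $(\vec\alpha,\vec\beta)$-colored Motzkin path is such a path in which, for each $0\le i\le \ell-1$, each $D_i$ step whose right endpoint is at height $0$ is labeled by one of $\alpha_i$ colors and each $D_i$ step whose right endpoint is at height $>0$ is labeled by one of $\beta_i$ colors; $U$ and $D_\ell$ steps are unlabeled. $M^\ell_{n,m}(\vec\alpha,\vec\beta)$ is the number of such colored paths of length $n$ and height $m$. -}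

module Defs where

open import Data.Nat using (ℕ; zero; suc; _+_; _∸_; _≤_)
open import Data.Fin using (Fin; toℕ)
open import Data.List using (List; []; _∷_; length)
open import Data.List.Relation.Unary.All using (All)
open import Data.Product using (Σ; _×_)
open import Relation.Binary.PropositionalEquality using (_≡_)
open import Function.Bundles using (_↔_)

data Tree : Set where
  node : List Tree → Tree

mutual
  edges : Tree → ℕ
  edges (node ts) = edgesList ts

  edgesList : List Tree → ℕ
  edgesList []       = 0
  edgesList (t ∷ ts) = suc (edges t) + edgesList ts

data IsKary (k : ℕ) : Tree → Set where
  node : ∀ {ts} → length ts ≤ k → All (IsKary k) ts → IsKary k (node ts)

KaryTree : ℕ → ℕ → Set
KaryTree k n = Σ Tree (λ t → IsKary k t × edges t ≡ n)

-- (α,β)-colored order-ℓ Motzkin paths.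
-- Label for a D_i step (0 ≤ i ≤ ℓ-1) given the height of its right endpoint.

Label : {ℓ : ℕ} → (α β : Fin ℓ → ℕ) → Fin ℓ → ℕ → Set
Label α β i zero    = Fin (α i)
Label α β i (suc _) = Fin (β i)

-- ColoredMotzkin ℓ α β n m : colored paths from (0,0) to (n,m), built by
-- appending steps on the right; the ≤-hypotheses ensure the path never
-- goes below y = 0.
data ColoredMotzkin (ℓ : ℕ) (α β : Fin ℓ → ℕ) : ℕ → ℕ → Set where
  empty : ColoredMotzkin ℓ α β 0 0
  stepU : ∀ {n h} → ColoredMotzkin ℓ α β n h → ColoredMotzkin ℓ α β (suc n) (suc h)
  stepD : ∀ {n h} → ColoredMotzkin ℓ α β n h → (i : Fin ℓ) → (p : toℕ i ≤ h) →
          Label α β i (h ∸ toℕ i) → ColoredMotzkin ℓ α β (suc n) (h ∸ toℕ i)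
  stepDℓ : ∀ {n h} → ColoredMotzkin ℓ α β n h → (p : ℓ ≤ h) →
           ColoredMotzkin ℓ α β (suc n) (h ∸ ℓ)

ones : {ℓ : ℕ} → Fin ℓ → ℕ
ones _ = 1

HasCard : Set → ℕ → Set
HasCard A m = A ↔ Fin m

-- Read an order-ℓ Motzkin path from left to right as a stack machine on
-- plane trees: the empty path is a single leaf, U pushes a new leaf, and
-- D_j (0 ≤ j ≤ ℓ) pops the top j + 1 trees and pushes a new vertex having them
-- as children.  A path of length n and height h thus builds a forest of
-- h + 1 trees with n + 1 vertices in total, each vertex having at most ℓ + 1
-- children.  When every colour class is a singleton no information is lost,
-- so this is a bijection; at height 0 the forests are single (ℓ+1)-ary trees
-- with n edges.  The common cardinality exists because paths are finite:
-- a path of length n + 1 is a path of length n followed by one legal step.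
module Submission where

open import Defs
open import Data.Empty using (⊥-elim)
open import Data.Fin using (Fin; toℕ; zero; suc)
open import Data.Fin.Properties using (toℕ-injective; toℕ<n; +↔⊎; 1↔⊤)
open import Data.List using (List; []; _∷_; length; take; drop; _++_)
open import Data.List.Properties
  using (length-take; length-drop; length-++; take++drop≡id; ∷-injectiveʳ)
open import Data.List.Relation.Unary.All using (All; []; _∷_)
open import Data.List.Relation.Unary.All.Properties using (++⁺; take⁺; drop⁺)
open import Data.Nat using (ℕ; zero; suc; _+_; _∸_; _≤_; _<_; z≤n; s≤s; _≤?_; _≟_)
open import Data.Nat.Properties
  using ( suc-injective; ≡-irrelevant; ≤-irrelevant; ≤-pred; ≤-trans; ≤-reflexive
        ; <-irrefl; m<n⇒m<1+n; n<1+n; m≤n⇒m⊓n≡m; m⊓n≤m; m≤m+n; m+n∸m≡n; +-assoc; +-identityʳ; m+1+n≢0 )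
open import Data.Product using (Σ; _×_; _,_; proj₁; proj₂; map)
open import Data.Product.Function.Dependent.Propositional using (Σ-↔)
open import Data.Product.Properties using (,-injectiveʳ-UIP)
open import Data.Sum using (_⊎_; inj₁; inj₂)
open import Data.Sum.Function.Propositional using (_⊎-↔_)
open import Data.Unit using (⊤; tt)
open import Function using (_∘_)
open import Function.Bundles using (_↔_; mk↔ₛ′)
open import Function.Properties.Inverse using (↔-refl; ↔-sym; ↔-trans)
open import Relation.Binary.PropositionalEquality
  using (_≡_; _≢_; refl; sym; trans; cong; cong₂; subst; module ≡-Reasoning)
open import Relation.Nullary using (Dec; yes; no)
open import Relation.Nullary.Irrelevant using (Irrelevant)

Finite : Set → Set
Finite A = Σ ℕ (λ m → A ↔ Fin m)

Finite-↔ : {A B : Set} → A ↔ B → Finite B → Finite A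
Finite-↔ A↔B (m , B↔m) = m , ↔-trans A↔B B↔m

Finite-Fin : ∀ m → Finite (Fin m)
Finite-Fin m = m , ↔-refl

Finite-⊤ : Finite ⊤
Finite-⊤ = 1 , ↔-sym 1↔⊤

Finite-⊎ : {A B : Set} → Finite A → Finite B → Finite (A ⊎ B)
Finite-⊎ (a , A↔a) (b , B↔b) = a + b , ↔-trans (A↔a ⊎-↔ B↔b) (↔-sym +↔⊎)

Finite-irrelevant : {P : Set} → Dec P → Irrelevant P → Finite P
Finite-irrelevant (yes p) irr = Finite-↔ (mk↔ₛ′ (λ _ → tt) (λ _ → p) (λ _ → refl) (irr p)) Finite-⊤
Finite-irrelevant (no ¬p) _   = 0 , mk↔ₛ′ (⊥-elim ∘ ¬p) (λ ()) (λ ()) (⊥-elim ∘ ¬p)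

Σ-Fin-suc↔ : ∀ {m} (B : Fin (suc m) → Set) → Σ (Fin (suc m)) B ↔ (B zero ⊎ Σ (Fin m) (B ∘ suc))
Σ-Fin-suc↔ {m} B = mk↔ₛ′ to from
  (λ { (inj₁ _) → refl ; (inj₂ _) → refl })
  (λ { (zero , _) → refl ; (suc _ , _) → refl })
  where
  to : Σ (Fin (suc m)) B → B zero ⊎ Σ (Fin m) (B ∘ suc)
  to (zero  , b) = inj₁ b
  to (suc i , b) = inj₂ (i , b)
  from : B zero ⊎ Σ (Fin m) (B ∘ suc) → Σ (Fin (suc m)) B
  from (inj₁ b)       = zero , b
  from (inj₂ (i , b)) = suc i , b

Finite-Σ-Fin : ∀ m (B : Fin m → Set) → (∀ i → Finite (B i)) → Finite (Σ (Fin m) B)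
Finite-Σ-Fin zero    B _   = 0 , mk↔ₛ′ (λ ()) (λ ()) (λ ()) (λ ())
Finite-Σ-Fin (suc m) B fin =
  Finite-↔ (Σ-Fin-suc↔ B) (Finite-⊎ (fin zero) (Finite-Σ-Fin m (B ∘ suc) (fin ∘ suc)))

Finite-Σ : {A : Set} {B : A → Set} → Finite A → (∀ a → Finite (B a)) → Finite (Σ A B)
Finite-Σ (m , A↔m) fin =
  Finite-↔ (↔-sym (Σ-↔ (↔-sym A↔m) ↔-refl)) (Finite-Σ-Fin m _ (λ i → fin _))

Finite-× : {A B : Set} → Finite A → Finite B → Finite (A × B)
Finite-× finA finB = Finite-Σ finA (λ _ → finB)

MotzkinPath : (ℓ : ℕ) (α β : Fin ℓ → ℕ) → ℕ → Set
MotzkinPath ℓ α β n = Σ ℕ (ColoredMotzkin ℓ α β n)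

module _ {ℓ : ℕ} {α β : Fin ℓ → ℕ} where

  LabelledDescent : ℕ → Set
  LabelledDescent h = Σ (Fin ℓ) (λ i → toℕ i ≤ h × Label α β i (h ∸ toℕ i))

  MotzkinPath-zero↔ : MotzkinPath ℓ α β 0 ↔ ⊤
  MotzkinPath-zero↔ = mk↔ₛ′ (λ _ → tt) (λ _ → 0 , empty) (λ _ → refl) (λ { (_ , empty) → refl })

  PathThenStep : ℕ → Set
  PathThenStep n = MotzkinPath ℓ α β n
                 ⊎ Σ (MotzkinPath ℓ α β n) (LabelledDescent ∘ proj₁)
                 ⊎ Σ (MotzkinPath ℓ α β n) (λ p → ℓ ≤ proj₁ p)

  MotzkinPath-suc↔ : ∀ {n} → MotzkinPath ℓ α β (suc n) ↔ PathThenStep n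
  MotzkinPath-suc↔ {n} = mk↔ₛ′ splitLast append
    (λ { (inj₁ _) → refl ; (inj₂ (inj₁ _)) → refl ; (inj₂ (inj₂ _)) → refl })
    (λ { (_ , stepU _) → refl ; (_ , stepD _ _ _ _) → refl ; (_ , stepDℓ _ _) → refl })
    where
    splitLast : MotzkinPath ℓ α β (suc n) → PathThenStep n
    splitLast (_ , stepU c)       = inj₁ (_ , c)
    splitLast (_ , stepD c i p l) = inj₂ (inj₁ ((_ , c) , i , p , l))
    splitLast (_ , stepDℓ c p)    = inj₂ (inj₂ ((_ , c) , p))
    append : PathThenStep n → MotzkinPath ℓ α β (suc n)
    append (inj₁ (_ , c))                      = _ , stepU c
    append (inj₂ (inj₁ ((_ , c) , i , p , l))) = _ , stepD c i p l
    append (inj₂ (inj₂ ((_ , c) , p)))         = _ , stepDℓ c p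

  Finite-Label : ∀ i h → Finite (Label α β i h)
  Finite-Label i zero    = Finite-Fin (α i)
  Finite-Label i (suc _) = Finite-Fin (β i)

  Finite-LabelledDescent : ∀ h → Finite (LabelledDescent h)
  Finite-LabelledDescent h = Finite-Σ (Finite-Fin ℓ) λ i →
    Finite-× (Finite-irrelevant (toℕ i ≤? h) ≤-irrelevant) (Finite-Label i (h ∸ toℕ i))

  Finite-MotzkinPath : ∀ n → Finite (MotzkinPath ℓ α β n)
  Finite-MotzkinPath zero    = Finite-↔ MotzkinPath-zero↔ Finite-⊤
  Finite-MotzkinPath (suc n) = Finite-↔ MotzkinPath-suc↔
    (Finite-⊎ fin (Finite-⊎ (Finite-Σ fin (Finite-LabelledDescent ∘ proj₁))
                            (Finite-Σ fin (λ p → Finite-irrelevant (ℓ ≤? proj₁ p) ≤-irrelevant))))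
    where
    fin : Finite (MotzkinPath ℓ α β n)
    fin = Finite-MotzkinPath n

  ColoredMotzkin↔fibre : ∀ {n h} →
    ColoredMotzkin ℓ α β n h ↔ Σ (MotzkinPath ℓ α β n) (λ p → proj₁ p ≡ h)
  ColoredMotzkin↔fibre = mk↔ₛ′ (λ c → (_ , c) , refl) (λ { ((_ , c) , refl) → c })
    (λ { ((_ , _) , refl) → refl }) (λ _ → refl)

  Finite-ColoredMotzkin : ∀ n h → Finite (ColoredMotzkin ℓ α β n h)
  Finite-ColoredMotzkin n h = Finite-↔ ColoredMotzkin↔fibre
    (Finite-Σ (Finite-MotzkinPath n) (λ p → Finite-irrelevant (proj₁ p ≟ h) ≡-irrelevant))

leaf : Tree
leaf = node []

graft : ℕ → List Tree → List Tree
graft j ts = node (take (suc j) ts) ∷ drop (suc j) ts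

-- edgesList of a forest counts its vertices: each tree contributes its edges
-- and its root.
Forest : ℕ → ℕ → ℕ → Set
Forest k n h = Σ (List Tree) λ ts → length ts ≡ suc h × All (IsKary k) ts × edgesList ts ≡ suc n

mutual
  IsKary-irrelevant : ∀ {k t} → Irrelevant (IsKary k t)
  IsKary-irrelevant (node p ps) (node q qs) = cong₂ node (≤-irrelevant p q) (All-IsKary-irrelevant ps qs)

  All-IsKary-irrelevant : ∀ {k ts} → Irrelevant (All (IsKary k) ts)
  All-IsKary-irrelevant []       []       = refl
  All-IsKary-irrelevant (p ∷ ps) (q ∷ qs) = cong₂ _∷_ (IsKary-irrelevant p q) (All-IsKary-irrelevant ps qs)

Forest-≡ : ∀ {k n h} {F G : Forest k n h} → proj₁ F ≡ proj₁ G → F ≡ G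
Forest-≡ {F = ts , L , a , e} {G = .ts , L′ , a′ , e′} refl
  with ≡-irrelevant L L′ | All-IsKary-irrelevant a a′ | ≡-irrelevant e e′
... | refl | refl | refl = refl

KaryTree↔Forest : ∀ k n → KaryTree k n ↔ Forest k n 0
KaryTree↔Forest k n = mk↔ₛ′ to from (λ { (_ ∷ [] , refl , _ ∷ [] , _) → Forest-≡ refl })
  (λ { (t , kt , e) → cong (λ e′ → t , kt , e′) (≡-irrelevant _ _) })
  where
  to : KaryTree k n → Forest k n 0
  to (t , kt , e) = t ∷ [] , refl , kt ∷ [] , cong suc (trans (+-identityʳ (edges t)) e)
  from : Forest k n 0 → KaryTree k n
  from (t ∷ [] , refl , kt ∷ [] , e) = t , kt , trans (sym (+-identityʳ (edges t))) (suc-injective e)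

edgesList-++ : ∀ xs ys → edgesList (xs ++ ys) ≡ edgesList xs + edgesList ys
edgesList-++ []       ys = refl
edgesList-++ (x ∷ xs) ys = cong suc (begin
  edges x + edgesList (xs ++ ys)          ≡⟨ cong (edges x +_) (edgesList-++ xs ys) ⟩
  edges x + (edgesList xs + edgesList ys) ≡⟨ +-assoc (edges x) _ _ ⟨
  edges x + edgesList xs + edgesList ys   ∎)
  where open ≡-Reasoning

take-length-++ : ∀ {A : Set} (xs ys : List A) → take (length xs) (xs ++ ys) ≡ xs
take-length-++ []       ys = refl
take-length-++ (x ∷ xs) ys = cong (x ∷_) (take-length-++ xs ys)

drop-length-++ : ∀ {A : Set} (xs ys : List A) → drop (length xs) (xs ++ ys) ≡ ys
drop-length-++ []       ys = refl
drop-length-++ (x ∷ xs) ys = drop-length-++ xs ys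

length-graft : ∀ j ts {h} → length ts ≡ suc h → length (graft j ts) ≡ suc (h ∸ j)
length-graft j ts eq = cong suc (trans (length-drop (suc j) ts) (cong (_∸ suc j) eq))

edgesList-graft : ∀ j ts → edgesList (graft j ts) ≡ suc (edgesList ts)
edgesList-graft j ts = cong suc (begin
  edgesList (take (suc j) ts) + edgesList (drop (suc j) ts) ≡⟨ edgesList-++ (take (suc j) ts) _ ⟨
  edgesList (take (suc j) ts ++ drop (suc j) ts)            ≡⟨ cong edgesList (take++drop≡id (suc j) ts) ⟩
  edgesList ts                                              ∎)
  where open ≡-Reasoning

graft-IsKary : ∀ {k j ts} → j < k → All (IsKary k) ts → All (IsKary k) (graft j ts)
graft-IsKary {j = j} {ts} j<k kts =
  node (≤-trans (≤-reflexive (length-take (suc j) ts)) (≤-trans (m⊓n≤m _ _) j<k)) (take⁺ (suc j) kts)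
  ∷ drop⁺ (suc j) kts

graft-++ : ∀ t ts us → graft (length ts) ((t ∷ ts) ++ us) ≡ node (t ∷ ts) ∷ us
graft-++ t ts us = cong₂ (λ cs vs → node (t ∷ cs) ∷ vs) (take-length-++ ts us) (drop-length-++ ts us)

length-ungraft : ∀ (c : Tree) cs ts {h} → length ts ≡ h → length ((c ∷ cs) ++ ts) ≡ suc (length cs + h)
length-ungraft c cs ts len = cong suc (trans (length-++ cs) (cong (length cs +_) len))

edgesList-ungraft : ∀ cs ts {n} → edgesList (node cs ∷ ts) ≡ suc (suc n) → edgesList (cs ++ ts) ≡ suc n
edgesList-ungraft cs ts e = trans (edgesList-++ cs ts) (suc-injective e)

length-take-suc : ∀ {j} (ts : List Tree) → suc j ≤ length ts → length (take (suc j) ts) ≡ suc j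
length-take-suc {j} ts j<len = trans (length-take (suc j) ts) (m≤n⇒m⊓n≡m j<len)

node∷-injective : ∀ {cs ds us vs : List Tree} → node cs ∷ us ≡ node ds ∷ vs → cs ≡ ds × us ≡ vs
node∷-injective refl = refl , refl

leaf∷≢graft : ∀ {j ts us} → suc j ≤ length ts → leaf ∷ us ≢ graft j ts
leaf∷≢graft {ts = ts} j<len eq with trans (cong length (proj₁ (node∷-injective eq))) (length-take-suc ts j<len)
... | ()

graft-injective : ∀ {i j xs ys} → suc i ≤ length xs → suc j ≤ length ys →
                  graft i xs ≡ graft j ys → i ≡ j × xs ≡ ys
graft-injective {i} {j} {xs} {ys} i<len j<len eq = i≡j , xs≡ys
  where
  open ≡-Reasoning
  children : take (suc i) xs ≡ take (suc j) ys
  children = proj₁ (node∷-injective eq)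
  i≡j : i ≡ j
  i≡j = suc-injective (begin
    suc i                      ≡⟨ length-take-suc xs i<len ⟨
    length (take (suc i) xs)   ≡⟨ cong length children ⟩
    length (take (suc j) ys)   ≡⟨ length-take-suc ys j<len ⟩
    suc j                      ∎)
  xs≡ys : xs ≡ ys
  xs≡ys = begin
    xs                                ≡⟨ take++drop≡id (suc i) xs ⟨
    take (suc i) xs ++ drop (suc i) xs ≡⟨ cong₂ _++_ children (proj₂ (node∷-injective eq)) ⟩
    take (suc j) ys ++ drop (suc j) ys ≡⟨ take++drop≡id (suc j) ys ⟩
    ys                                ∎

module _ {ℓ : ℕ} {α β : Fin ℓ → ℕ} where

  forest : ∀ {n h} → ColoredMotzkin ℓ α β n h → List Tree
  forest empty            = leaf ∷ []
  forest (stepU c)        = leaf ∷ forest c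
  forest (stepD c i _ _)  = graft (toℕ i) (forest c)
  forest (stepDℓ c _)     = graft ℓ (forest c)

  length-forest : ∀ {n h} (c : ColoredMotzkin ℓ α β n h) → length (forest c) ≡ suc h
  length-forest empty           = refl
  length-forest (stepU c)       = cong suc (length-forest c)
  length-forest (stepD c i _ _) = length-graft (toℕ i) (forest c) (length-forest c)
  length-forest (stepDℓ c _)    = length-graft ℓ (forest c) (length-forest c)

  edgesList-forest : ∀ {n h} (c : ColoredMotzkin ℓ α β n h) → edgesList (forest c) ≡ suc n
  edgesList-forest empty           = refl
  edgesList-forest (stepU c)       = cong suc (edgesList-forest c)
  edgesList-forest (stepD c i _ _) = trans (edgesList-graft (toℕ i) (forest c)) (cong suc (edgesList-forest c))
  edgesList-forest (stepDℓ c _)    = trans (edgesList-graft ℓ (forest c)) (cong suc (edgesList-forest c))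

  forest-IsKary : ∀ {n h} (c : ColoredMotzkin ℓ α β n h) → All (IsKary (suc ℓ)) (forest c)
  forest-IsKary empty           = node z≤n [] ∷ []
  forest-IsKary (stepU c)       = node z≤n [] ∷ forest-IsKary c
  forest-IsKary (stepD c i _ _) = graft-IsKary (m<n⇒m<1+n (toℕ<n i)) (forest-IsKary c)
  forest-IsKary (stepDℓ c _)    = graft-IsKary (n<1+n ℓ) (forest-IsKary c)

  suc-≤-length-forest : ∀ {n h j} (c : ColoredMotzkin ℓ α β n h) → j ≤ h → suc j ≤ length (forest c)
  suc-≤-length-forest c j≤h = subst (_ ≤_) (sym (length-forest c)) (s≤s j≤h)

  graft-forest-injective : ∀ {n h₁ h₂ i j}
    (c₁ : ColoredMotzkin ℓ α β n h₁) (c₂ : ColoredMotzkin ℓ α β n h₂) → i ≤ h₁ → j ≤ h₂ →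
    graft i (forest c₁) ≡ graft j (forest c₂) → i ≡ j × forest c₁ ≡ forest c₂
  graft-forest-injective c₁ c₂ p₁ p₂ = graft-injective (suc-≤-length-forest c₁ p₁) (suc-≤-length-forest c₂ p₂)

  leaf∷≢graft-forest : ∀ {n h j us} (c : ColoredMotzkin ℓ α β n h) → j ≤ h → leaf ∷ us ≢ graft j (forest c)
  leaf∷≢graft-forest c p = leaf∷≢graft (suc-≤-length-forest c p)

  forest-subst : ∀ {n h h′} (eq : h ≡ h′) (c : ColoredMotzkin ℓ α β n h) →
                 forest (subst (ColoredMotzkin ℓ α β n) eq c) ≡ forest c
  forest-subst refl c = refl

data Descent (ℓ : ℕ) : ℕ → Set where
  D  : (i : Fin ℓ) → Descent ℓ (toℕ i)
  Dℓ : Descent ℓ ℓ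

descent : ∀ {ℓ j} → j ≤ ℓ → Descent ℓ j
descent {zero}  z≤n     = Dℓ
descent {suc ℓ} z≤n     = D zero
descent         (s≤s p) with descent p
... | D i = D (suc i)
... | Dℓ  = Dℓ

module _ (ℓ : ℕ) where

  Motzkin : ℕ → ℕ → Set
  Motzkin = ColoredMotzkin ℓ ones ones

  label : ∀ i h → Label {ℓ} ones ones i h
  label i zero    = zero
  label i (suc h) = zero

  Label-irrelevant : ∀ i h → Irrelevant (Label {ℓ} ones ones i h)
  Label-irrelevant i zero    zero zero = refl
  Label-irrelevant i (suc h) zero zero = refl

  stepD-cong : ∀ {n h₁ h₂ i} {c₁ : Motzkin n h₁} {c₂ : Motzkin n h₂}
               (p₁ : toℕ i ≤ h₁) (p₂ : toℕ i ≤ h₂) l₁ l₂ →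
               _≡_ {A = MotzkinPath ℓ ones ones n} (h₁ , c₁) (h₂ , c₂) →
               _≡_ {A = MotzkinPath ℓ ones ones (suc n)}
                   (h₁ ∸ toℕ i , stepD c₁ i p₁ l₁) (h₂ ∸ toℕ i , stepD c₂ i p₂ l₂)
  stepD-cong {i = i} p₁ p₂ l₁ l₂ refl
    rewrite ≤-irrelevant p₁ p₂ | Label-irrelevant i _ l₁ l₂ = refl

  stepDℓ-cong : ∀ {n h₁ h₂} {c₁ : Motzkin n h₁} {c₂ : Motzkin n h₂} (p₁ : ℓ ≤ h₁) (p₂ : ℓ ≤ h₂) →
                _≡_ {A = MotzkinPath ℓ ones ones n} (h₁ , c₁) (h₂ , c₂) →
                _≡_ {A = MotzkinPath ℓ ones ones (suc n)} (h₁ ∸ ℓ , stepDℓ c₁ p₁) (h₂ ∸ ℓ , stepDℓ c₂ p₂)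
  stepDℓ-cong p₁ p₂ refl rewrite ≤-irrelevant p₁ p₂ = refl

  forest-injective : ∀ {n h₁ h₂} (c₁ : Motzkin n h₁) (c₂ : Motzkin n h₂) → forest c₁ ≡ forest c₂ →
                     _≡_ {A = MotzkinPath ℓ ones ones n} (h₁ , c₁) (h₂ , c₂)
  forest-injective empty empty _ = refl
  forest-injective (stepU c₁) (stepU c₂) eq = cong (map suc stepU) (forest-injective c₁ c₂ (∷-injectiveʳ eq))
  forest-injective (stepU _) (stepD c₂ _ p₂ _) eq = ⊥-elim (leaf∷≢graft-forest c₂ p₂ eq)
  forest-injective (stepU _) (stepDℓ c₂ p₂)    eq = ⊥-elim (leaf∷≢graft-forest c₂ p₂ eq)
  forest-injective (stepD c₁ _ p₁ _) (stepU _) eq = ⊥-elim (leaf∷≢graft-forest c₁ p₁ (sym eq))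
  forest-injective (stepDℓ c₁ p₁)    (stepU _) eq = ⊥-elim (leaf∷≢graft-forest c₁ p₁ (sym eq))
  forest-injective (stepD c₁ i p₁ l₁) (stepD c₂ j p₂ l₂) eq with graft-forest-injective c₁ c₂ p₁ p₂ eq
  ... | i≡j , forests≡ with toℕ-injective i≡j
  ... | refl = stepD-cong p₁ p₂ l₁ l₂ (forest-injective c₁ c₂ forests≡)
  forest-injective (stepD c₁ i p₁ _) (stepDℓ c₂ p₂) eq =
    ⊥-elim (<-irrefl (proj₁ (graft-forest-injective c₁ c₂ p₁ p₂ eq)) (toℕ<n i))
  forest-injective (stepDℓ c₁ p₁) (stepD c₂ j p₂ _) eq =
    ⊥-elim (<-irrefl (sym (proj₁ (graft-forest-injective c₁ c₂ p₁ p₂ eq))) (toℕ<n j))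
  forest-injective (stepDℓ c₁ p₁) (stepDℓ c₂ p₂) eq =
    stepDℓ-cong p₁ p₂ (forest-injective c₁ c₂ (proj₂ (graft-forest-injective c₁ c₂ p₁ p₂ eq)))

  descend : ∀ {n h j} → Descent ℓ j → Motzkin n (j + h) → Motzkin (suc n) h
  descend {n} {h} (D i) c =
    subst (Motzkin (suc n)) (m+n∸m≡n (toℕ i) h) (stepD c i (m≤m+n (toℕ i) h) (label i _))
  descend {n} {h} Dℓ    c =
    subst (Motzkin (suc n)) (m+n∸m≡n ℓ h) (stepDℓ c (m≤m+n ℓ h))

  forest-descend : ∀ {n h j} (d : Descent ℓ j) (c : Motzkin n (j + h)) →
                   forest (descend d c) ≡ graft j (forest c)
  forest-descend {h = h} (D i) c = forest-subst (m+n∸m≡n (toℕ i) h) _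
  forest-descend {h = h} Dℓ    c = forest-subst (m+n∸m≡n ℓ h) _

  unforest : ∀ n h ts → length ts ≡ suc h → All (IsKary (suc ℓ)) ts → edgesList ts ≡ suc n → Motzkin n h
  unforest n       h []                   ()   _ _
  unforest zero    h (node [] ∷ [])       refl _ _ = empty
  unforest zero    h (node (_ ∷ _) ∷ [])  _    _ ()
  unforest zero    h (t ∷ _ ∷ _)          _    _ e = ⊥-elim (m+1+n≢0 (edges t) (suc-injective e))
  unforest (suc n) h (node [] ∷ [])       _    _ ()
  unforest (suc n) h (node [] ∷ u ∷ us)   refl (_ ∷ kts) e =
    stepU (unforest n (length us) (u ∷ us) refl kts (suc-injective e))
  unforest (suc n) h (node (c ∷ cs) ∷ ts) len (node c≤k kcs ∷ kts) e =
    descend (descent (≤-pred c≤k))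
      (unforest n (length cs + h) ((c ∷ cs) ++ ts)
        (length-ungraft c cs ts (suc-injective len)) (++⁺ kcs kts) (edgesList-ungraft (c ∷ cs) ts e))

  forest-unforest : ∀ n h ts (len : length ts ≡ suc h) kts (e : edgesList ts ≡ suc n) →
                    forest (unforest n h ts len kts e) ≡ ts
  forest-unforest n       h []                   ()   _ _
  forest-unforest zero    h (node [] ∷ [])       refl _ _ = refl
  forest-unforest zero    h (node (_ ∷ _) ∷ [])  _    _ ()
  forest-unforest zero    h (t ∷ _ ∷ _)          _    _ e = ⊥-elim (m+1+n≢0 (edges t) (suc-injective e))
  forest-unforest (suc n) h (node [] ∷ [])       _    _ ()
  forest-unforest (suc n) h (node [] ∷ u ∷ us)   refl (_ ∷ kts) e =
    cong (leaf ∷_) (forest-unforest n (length us) (u ∷ us) refl kts (suc-injective e))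
  forest-unforest (suc n) h (node (c ∷ cs) ∷ ts) len (node c≤k kcs ∷ kts) e = begin
    forest (descend (descent (≤-pred c≤k)) rest)   ≡⟨ forest-descend (descent (≤-pred c≤k)) rest ⟩
    graft (length cs) (forest rest)                ≡⟨ cong (graft (length cs)) (forest-unforest n _ _ len′ kts′ e′) ⟩
    graft (length cs) ((c ∷ cs) ++ ts)             ≡⟨ graft-++ c cs ts ⟩
    node (c ∷ cs) ∷ ts                             ∎
    where
    open ≡-Reasoning
    len′ : length ((c ∷ cs) ++ ts) ≡ suc (length cs + h)
    len′ = length-ungraft c cs ts (suc-injective len)
    kts′ : All (IsKary (suc ℓ)) ((c ∷ cs) ++ ts)
    kts′ = ++⁺ kcs kts
    e′ : edgesList ((c ∷ cs) ++ ts) ≡ suc n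
    e′ = edgesList-ungraft (c ∷ cs) ts e
    rest : Motzkin n (length cs + h)
    rest = unforest n (length cs + h) ((c ∷ cs) ++ ts) len′ kts′ e′

  Motzkin↔Forest : ∀ n h → Motzkin n h ↔ Forest (suc ℓ) n h
  Motzkin↔Forest n h = mk↔ₛ′ to from
    (λ { (ts , len , kts , e) → Forest-≡ (forest-unforest n h ts len kts e) })
    (λ c → ,-injectiveʳ-UIP ≡-irrelevant (forest-injective (from (to c)) c (forest-unforest n h _ _ _ _)))
    where
    to : Motzkin n h → Forest (suc ℓ) n h
    to c = forest c , length-forest c , forest-IsKary c , edgesList-forest c
    from : Forest (suc ℓ) n h → Motzkin n h
    from (ts , len , kts , e) = unforest n h ts len kts e

proposition3p11 : (n k : ℕ) → 2 ≤ k →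
    Σ ℕ (λ m → HasCard (KaryTree k n) m × HasCard (ColoredMotzkin (k ∸ 1) ones ones n 0) m)
proposition3p11 n zero    ()
proposition3p11 n (suc ℓ) _ =
  m , ↔-trans (KaryTree↔Forest (suc ℓ) n) (↔-trans (↔-sym (Motzkin↔Forest ℓ n 0)) Motzkin↔m) , Motzkin↔m
  where
  m : ℕ
  m = proj₁ (Finite-ColoredMotzkin n 0)
  Motzkin↔m : Motzkin ℓ n 0 ↔ Fin m
  Motzkin↔m = proj₂ (Finite-ColoredMotzkin n 0)
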